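{- Let $G=(V,E)$ be a bipartite graph in which every vertex $u$ has as preference an arbitrary strict partial order $>_u$ on its neighbour set $N(u)$. Then the convex hull in $\mathbb{R}^E$ of the incidence vectors of all super-stable matchings of $G$ equals the set of $x\in\mathbb{R}^E$ satisfying $$\sum_{u\in N(v)} x_{u,v}\le 1\quad\forall v\in V,$$ $$\sum_{i>_u v} x_{u,i}+\sum_{j>_v u} x_{j,v}+x_{u,v}\ge 1\quad\forall (u,v)\in E,$$ $$x_{u,v}\ge 0\quad\forall (u,v)\in E.$$
   Context: $i>_u v$ means $u$ strictly prefers $i$ to $v$ in its partial order; the sum $\sum_{i>_u v}x_{u,i}$ ranges over neighbours $i$ of $u$ with $i>_u v$; $x_{u,v}$ is the coordinate of edge $\{u,v\}$. For a matching $M$, an edge $(x,y)\in E\setminus M$ blocks $M$ if neither endpoint would be worse off by being matched to the other, i.e. ($x$ is unmatched or $x$ does not strictly prefer its partner $M(x)$ to $y$) and ($y$ is unmatched or $y$ does not strictly prefer $M(y)$ to $x$); $M$ is super-stable if no edge blocks it.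
   Formalization: The vectors x are taken in ℚ^E instead of ℝ^E, and the convex hull of incidence vectors of super-stable matchings is formed with rational weights. -}

module Defs where

open import Data.Nat using (ℕ; zero; suc)
open import Data.Fin using (Fin; zero; suc)
open import Data.Bool using (Bool; true; false; T; if_then_else_)
open import Data.Rational using (ℚ; 0ℚ; 1ℚ; _+_; _*_; _≤_)
open import Data.Product using (Σ; _×_; _,_; ∃-syntax)
open import Data.List using (List; []; _∷_)
open import Data.List.Relation.Unary.All using (All)
open import Relation.Nullary using (¬_)
open import Relation.Binary.PropositionalEquality using (_≡_)

∑ : ∀ {n} → (Fin n → ℚ) → ℚ
∑ {zero} f = 0ℚ
∑ {suc n} f = f zero + ∑ (λ i → f (suc i))

-- A bipartite graph with colour classes L = Fin m and R = Fin k;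
-- edge {a , b} (a ∈ L, b ∈ R) present iff T (adj a b).
-- prefL a : strict preference of left vertex a over right vertices,
--   prefL a b b' = true  means  b >_a b'.
-- prefR b : strict preference of right vertex b over left vertices.
-- Each is required to be a strict partial order (irreflexive, transitive);
-- only comparisons between neighbours are ever used, so this is the same
-- as an arbitrary strict partial order on each neighbourhood.
record PrefGraph (m k : ℕ) : Set where
  field
    adj   : Fin m → Fin k → Bool
    prefL : Fin m → Fin k → Fin k → Bool
    prefR : Fin k → Fin m → Fin m → Bool
    prefL-irrefl : ∀ a b → ¬ T (prefL a b b)
    prefL-trans  : ∀ a b₁ b₂ b₃ → T (prefL a b₁ b₂) → T (prefL a b₂ b₃) → T (prefL a b₁ b₃)
    prefR-irrefl : ∀ b a → ¬ T (prefR b a a)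
    prefR-trans  : ∀ b a₁ a₂ a₃ → T (prefR b a₁ a₂) → T (prefR b a₂ a₃) → T (prefR b a₁ a₃)

module _ {m k : ℕ} (G : PrefGraph m k) where
  open PrefGraph G

  EdgeSet : Set
  EdgeSet = Fin m → Fin k → Bool

  IsMatching : EdgeSet → Set
  IsMatching M =
    (∀ a b → T (M a b) → T (adj a b)) ×
    (∀ a b b' → T (M a b) → T (M a b') → b ≡ b') ×
    (∀ a a' b → T (M a b) → T (M a' b) → a ≡ a')

  Blocks : EdgeSet → Fin m → Fin k → Set
  Blocks M a b =
    T (adj a b) × ¬ T (M a b) ×
    (∀ b' → T (M a b') → ¬ T (prefL a b' b)) ×
    (∀ a' → T (M a' b) → ¬ T (prefR b a' a))

  IsSuperStable : EdgeSet → Set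
  IsSuperStable M = IsMatching M × (∀ a b → ¬ Blocks M a b)

  χ : EdgeSet → Fin m → Fin k → ℚ
  χ M a b = if M a b then 1ℚ else 0ℚ

  -- Vectors in ℚ^E are represented as functions on L × R vanishing off E.
  Vec^E : (Fin m → Fin k → ℚ) → Set
  Vec^E x = ∀ a b → ¬ T (adj a b) → x a b ≡ 0ℚ

  combo : List (ℚ × EdgeSet) → Fin m → Fin k → ℚ
  combo [] a b = 0ℚ
  combo ((λ₀ , M) ∷ ps) a b = λ₀ * χ M a b + combo ps a b

  weightSum : List (ℚ × EdgeSet) → ℚ
  weightSum [] = 0ℚ
  weightSum ((λ₀ , _) ∷ ps) = λ₀ + weightSum ps

  InSuperStableHull : (Fin m → Fin k → ℚ) → Set
  InSuperStableHull x =
    ∃[ ps ] (All (λ p → (0ℚ ≤ Data.Product.proj₁ p) × IsSuperStable (Data.Product.proj₂ p)) ps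
             × weightSum ps ≡ 1ℚ
             × (∀ a b → x a b ≡ combo ps a b))

  InPolytope : (Fin m → Fin k → ℚ) → Set
  InPolytope x =
    (∀ a → ∑ (λ b → if adj a b then x a b else 0ℚ) ≤ 1ℚ) ×
    (∀ b → ∑ (λ a → if adj a b then x a b else 0ℚ) ≤ 1ℚ) ×
    (∀ a b → T (adj a b) →
       1ℚ ≤ (∑ (λ i → if adj a i then (if prefL a i b then x a i else 0ℚ) else 0ℚ)
            + ∑ (λ j → if adj j b then (if prefR b j a then x j b else 0ℚ) else 0ℚ))
            + x a b) ×
    (∀ a b → T (adj a b) → 0ℚ ≤ x a b)

-- The constraints are linear and every super-stable matching M satisfies them: its
-- degrees are at most 1, and an edge ab ∉ M that is not blocking is dominated at a or at b by an
-- M-edge.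
--
-- Conversely let x satisfy them and put Aˡ(a,b) = Σ_{i >_a b} x(a,i) and Aʳ(b,a) = Σ_{j >_b a} x(j,b).
-- Expanding the square of the degree d(v) along the order at v and summing over all vertices gives
--   Σ_v d(v)² = 2 Σ_e x(e) (Aˡ(e) + Aʳ(e) + x(e)) + (mass of pairs of edges at a common vertex
--                                                  whose other ends are incomparable).
-- The left side is at most Σ_v d(v) = 2 Σ_e x(e) because d(v) ≤ 1, while x(e) (Aˡ + Aʳ + x)(e) ≥ x(e)
-- on every edge. So every edge of the support of x is tight, Aˡ + Aʳ + x = 1, and the support at
-- each vertex is a chain. Give edge ab the interval [Aˡ(a,b), Aˡ(a,b) + x(a,b)) ⊆ [0,1). At a left
-- vertex the chain makes these intervals disjoint; at a right vertex tightness rewrites them as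
-- [1 - Aʳ - x, 1 - Aʳ), disjoint for the same reason. So for t ∈ [0,1) the edges whose interval
-- contains t form a matching M_t, and a blocking edge would force some better partner into M_t:
-- M_t is super-stable. Cutting [0,1) at all interval endpoints t₀ < … < t_r writes x as
-- Σ (t_{i+1} - t_i) χ(M_{t_i}).

module Submission where

open import Defs
open import Level using (0ℓ)
open import Function.Base using (_∘_)
open import Function.Bundles using (_⇔_; Equivalence; mk⇔)
open import Data.Product using (_×_; _,_; proj₁; proj₂; ∃-syntax)
open import Data.Sum as Sum using (_⊎_; inj₁; inj₂; [_,_]; map₂)
open import Data.Maybe as Maybe using (Maybe)
open import Data.Bool using (Bool; true; false; T; if_then_else_; not; _∨_)
open import Data.Bool.Properties using (T-∨; T-≡)
open import Data.Nat using (ℕ; zero; suc)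
open import Data.Fin as Fin using (Fin; zero; suc)
open import Data.Fin.Properties using (any?; suc-injective)
open import Data.Rational
  using (ℚ; 0ℚ; 1ℚ; _+_; _*_; _-_; -_; _≤_; _<_; _≤?_; _<?_; nonNegative; positive)
open import Data.Rational.Properties
open import Data.List using (List; []; _∷_; allFin; filter; concatMap; cartesianProduct)
open import Data.List.Relation.Unary.Any using (here; there)
open import Data.List.Relation.Unary.All using (All; lookup; universal; []; _∷_)
open import Data.List.Relation.Unary.All.Properties using (all-filter; concat⁺; map⁺)
open import Data.List.Relation.Unary.Linked using (Linked; _∷_)
open import Data.List.Relation.Unary.Linked.Properties using (Linked⇒All)
open import Data.List.Membership.Propositional using (_∈_; lose)
open import Data.List.Membership.Propositional.Properties
  using (∈-allFin; ∈-filter⁺; ∈-concatMap⁺; ∈-cartesianProduct⁺)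
open import Data.List.Relation.Binary.Permutation.Propositional using (↭-sym)
open import Data.List.Relation.Binary.Permutation.Propositional.Properties
  using (All-resp-↭; ∈-resp-↭)
open import Data.List.Sort ≤-decTotalOrder using (sort; sort-↭; sort-↗)
import Data.List.Extrema
open import Relation.Nullary using (¬_; yes; no; Dec; contradiction; _×-dec_)
open import Relation.Nullary.Decidable
  using (⌊_⌋; T?; dec⇒maybe; dec-true; dec-false; isYes≗does; toWitness; fromWitness)
open import Relation.Unary using (Decidable)
open import Relation.Binary.Bundles using (DecTotalOrder)
open import Relation.Binary.PropositionalEquality
  using (_≡_; _≢_; refl; sym; trans; cong; cong₂; subst; subst₂; module ≡-Reasoning)
open import Algebra.Bundles using (CommutativeRing)
open import Algebra.Properties.CommutativeMonoid.Sum +-0-commutativeMonoid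
  using (sum; ∑-distrib-+; ∑-comm)
open import Algebra.Properties.Semiring.Sum (CommutativeRing.semiring +-*-commutativeRing)
  using (*-distribˡ-sum)
open import Tactic.RingSolver using (solve-∀)
open import Tactic.RingSolver.Core.AlmostCommutativeRing
  using (AlmostCommutativeRing; fromCommutativeRing)

ℚ-ring : AlmostCommutativeRing 0ℓ 0ℓ
ℚ-ring = fromCommutativeRing +-*-commutativeRing 0≟
  where
  0≟ : ∀ p → Maybe (0ℚ ≡ p)
  0≟ p = Maybe.map sym (dec⇒maybe (p ≟ 0ℚ))

private
  p+[q-p]≡q : ∀ p q → p + (q - p) ≡ q
  p+[q-p]≡q = solve-∀ ℚ-ring

  p+q-p≡q : ∀ p q → p + q - p ≡ q
  p+q-p≡q = solve-∀ ℚ-ring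

≤-fromDiff : ∀ {p q d} → q - p ≡ d → 0ℚ ≤ d → p ≤ q
≤-fromDiff {p} {q} q-p≡d 0≤d =
  subst₂ _≤_ (+-identityʳ p) (p+[q-p]≡q p q) (+-monoʳ-≤ p (subst (0ℚ ≤_) (sym q-p≡d) 0≤d))

<-fromDiff : ∀ {p q d} → q - p ≡ d → 0ℚ < d → p < q
<-fromDiff {p} {q} q-p≡d 0<d =
  subst₂ _<_ (+-identityʳ p) (p+[q-p]≡q p q) (+-monoʳ-< p (subst (0ℚ <_) (sym q-p≡d) 0<d))

p≤q⇒0≤q-p : ∀ {p q} → p ≤ q → 0ℚ ≤ q - p
p≤q⇒0≤q-p {p} {q} p≤q = subst (_≤ q - p) (+-inverseʳ p) (+-monoˡ-≤ (- p) p≤q)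

p<q⇒0<q-p : ∀ {p q} → p < q → 0ℚ < q - p
p<q⇒0<q-p {p} {q} p<q = subst (_< q - p) (+-inverseʳ p) (+-monoˡ-< (- p) p<q)

≤⇒≯ : ∀ {p q} → p ≤ q → ¬ q < p
≤⇒≯ p≤q q<p = <-irrefl refl (<-≤-trans q<p p≤q)

p≤p+q : ∀ {p q} → 0ℚ ≤ q → p ≤ p + q
p≤p+q {p} {q} = ≤-fromDiff (p+q-p≡q p q)

q≤p+q : ∀ {p q} → 0ℚ ≤ p → q ≤ p + q
q≤p+q {p} {q} 0≤p = subst (q ≤_) (+-comm q p) (p≤p+q 0≤p)

p<p+q : ∀ {p q} → 0ℚ < q → p < p + q
p<p+q {p} {q} = <-fromDiff (p+q-p≡q p q)

+-nonNeg : ∀ {p q} → 0ℚ ≤ p → 0ℚ ≤ q → 0ℚ ≤ p + q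
+-nonNeg = +-mono-≤

*-nonNeg : ∀ {p q} → 0ℚ ≤ p → 0ℚ ≤ q → 0ℚ ≤ p * q
*-nonNeg {p} {q} 0≤p 0≤q =
  nonNegative⁻¹ (p * q) {{nonNeg*nonNeg⇒nonNeg p {{nonNegative 0≤p}} q {{nonNegative 0≤q}}}}

*-pos : ∀ {p q} → 0ℚ < p → 0ℚ < q → 0ℚ < p * q
*-pos {p} {q} 0<p 0<q = positive⁻¹ (p * q) {{pos*pos⇒pos p {{positive 0<p}} q {{positive 0<q}}}}

0≤1 : 0ℚ ≤ 1ℚ
0≤1 = <⇒≤ (positive⁻¹ 1ℚ)

≤-some-summand : ∀ {p q r u} → 0ℚ ≤ p → 0ℚ ≤ q → 0ℚ ≤ r →
                 u ≤ p ⊎ u ≤ q ⊎ u ≤ r → u ≤ (p + q) + r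
≤-some-summand _   0≤q 0≤r (inj₁ u≤p)        = ≤-trans (≤-trans u≤p (p≤p+q 0≤q)) (p≤p+q 0≤r)
≤-some-summand 0≤p _   0≤r (inj₂ (inj₁ u≤q)) = ≤-trans (≤-trans u≤q (q≤p+q 0≤p)) (p≤p+q 0≤r)
≤-some-summand 0≤p 0≤q _   (inj₂ (inj₂ u≤r)) = ≤-trans u≤r (q≤p+q (+-nonNeg 0≤p 0≤q))

+-mono-≤-tight : ∀ {a b c d} → a ≤ b → c ≤ d → b + d ≤ a + c → b ≤ a × d ≤ c
+-mono-≤-tight {a} {b} {c} {d} a≤b c≤d b+d≤a+c =
  ≤-fromDiff (regroup a b c d) (+-nonNeg slack (p≤q⇒0≤q-p c≤d)) ,
  ≤-fromDiff (regroup c d a b)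
    (+-nonNeg (subst (0ℚ ≤_) (reorder a b c d) slack) (p≤q⇒0≤q-p a≤b))
  where
  slack = p≤q⇒0≤q-p b+d≤a+c
  regroup : ∀ a b c d → a - b ≡ (a + c - (b + d)) + (d - c)
  regroup = solve-∀ ℚ-ring
  reorder : ∀ a b c d → a + c - (b + d) ≡ c + a - (d + b)
  reorder = solve-∀ ℚ-ring

square≤self : ∀ {d} → 0ℚ ≤ d → d ≤ 1ℚ → d * d ≤ d
square≤self {d} 0≤d d≤1 = ≤-fromDiff (factor d) (*-nonNeg 0≤d (p≤q⇒0≤q-p d≤1))
  where
  factor : ∀ d → d - d * d ≡ d * (1ℚ - d)
  factor = solve-∀ ℚ-ring

squeeze : ∀ {D S I J} → (D + D) + (I + J) ≤ S + S → S ≤ D → 0ℚ ≤ I → 0ℚ ≤ J →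
          D ≤ S × I ≤ 0ℚ × J ≤ 0ℚ
squeeze {D} {S} {I} {J} bound S≤D 0≤I 0≤J =
  ≤-fromDiff (D-gap D S I J) (+-nonNeg (+-nonNeg (+-nonNeg slack excess) 0≤I) 0≤J) ,
  ≤-fromDiff (I-gap D S I J) (+-nonNeg (+-nonNeg (+-nonNeg slack excess) excess) 0≤J) ,
  ≤-fromDiff (J-gap D S I J) (+-nonNeg (+-nonNeg (+-nonNeg slack excess) excess) 0≤I)
  where
  slack = p≤q⇒0≤q-p bound
  excess = p≤q⇒0≤q-p S≤D
  D-gap : ∀ D S I J → S - D ≡ (S + S - ((D + D) + (I + J))) + (D - S) + I + J
  D-gap = solve-∀ ℚ-ring
  I-gap : ∀ D S I J → 0ℚ - I ≡ (S + S - ((D + D) + (I + J))) + (D - S) + (D - S) + J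
  I-gap = solve-∀ ℚ-ring
  J-gap : ∀ D S I J → 0ℚ - J ≡ (S + S - ((D + D) + (I + J))) + (D - S) + (D - S) + I
  J-gap = solve-∀ ℚ-ring

1-antimono : ∀ {p q} → p ≤ q → 1ℚ - q ≤ 1ℚ - p
1-antimono p≤q = +-monoʳ-≤ 1ℚ (neg-antimono-≤ p≤q)

1-p≤q⇒1-q≤p : ∀ {p q} → 1ℚ - p ≤ q → 1ℚ - q ≤ p
1-p≤q⇒1-q≤p {p} {q} h = ≤-fromDiff (swap p q) (p≤q⇒0≤q-p h)
  where
  swap : ∀ p q → p - (1ℚ - q) ≡ q - (1ℚ - p)
  swap = solve-∀ ℚ-ring

p<1-q⇒q<1-p : ∀ {p q} → p < 1ℚ - q → q < 1ℚ - p
p<1-q⇒q<1-p {p} {q} h = <-fromDiff (swap p q) (p<q⇒0<q-p h)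
  where
  swap : ∀ p q → 1ℚ - p - q ≡ 1ℚ - q - p
  swap = solve-∀ ℚ-ring

zero-width : ∀ {t t'} v r → t' ≡ t → (t' - t) * v + r ≡ r
zero-width {t} v r refl =
  trans (cong (λ d → d * v + r) (+-inverseʳ t)) (trans (cong (_+ r) (*-zeroˡ v)) (+-identityˡ r))

pos-unless-zero : ∀ {Q : ℚ → Set} {v} → ¬ Q 0ℚ → 0ℚ ≤ v → Q v → 0ℚ < v
pos-unless-zero {Q} {v} ¬Q0 0≤v Qv with 0ℚ <? v
... | yes 0<v = 0<v
... | no ¬0<v = contradiction (subst Q (≤-antisym (≮⇒≥ ¬0<v) 0≤v) Qv) ¬Q0

if-T : ∀ {c} {v w : ℚ} → T c → (if c then v else w) ≡ v
if-T {true} _ = refl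

if-¬T : ∀ {c} {v w : ℚ} → ¬ T c → (if c then v else w) ≡ w
if-¬T {true} ¬c = contradiction _ ¬c
if-¬T {false} _ = refl

if-nonNeg : ∀ c {v} → 0ℚ ≤ v → 0ℚ ≤ (if c then v else 0ℚ)
if-nonNeg true 0≤v = 0≤v
if-nonNeg false _ = ≤-refl

if-≤ : ∀ c {v} → 0ℚ ≤ v → (if c then v else 0ℚ) ≤ v
if-≤ true _ = ≤-refl
if-≤ false 0≤v = 0≤v

if-mono : ∀ {c d v} → (T c → T d) → 0ℚ ≤ v → (if c then v else 0ℚ) ≤ (if d then v else 0ℚ)
if-mono {true} {true} _ _ = ≤-refl
if-mono {true} {false} c⇒d _ = contradiction (c⇒d _) λ ()
if-mono {false} {d} _ 0≤v = if-nonNeg d 0≤v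

if-cong : ∀ {c d v} → (T c → T d) → (T d → T c) → (if c then v else 0ℚ) ≡ (if d then v else 0ℚ)
if-cong {true} {true} _ _ = refl
if-cong {true} {false} c⇒d _ = contradiction (c⇒d _) λ ()
if-cong {false} {true} _ d⇒c = contradiction (d⇒c _) λ ()
if-cong {false} {false} _ _ = refl

if-vanish : ∀ c {v} → v ≡ 0ℚ → (if c then v else 0ℚ) ≡ 0ℚ
if-vanish true v≡0 = v≡0
if-vanish false _ = refl

if-self : ∀ c {v} → (¬ T c → v ≡ 0ℚ) → (if c then v else 0ℚ) ≡ v
if-self true _ = refl
if-self false v≡0 = sym (v≡0 λ ())

if-pos : ∀ c {v} → 0ℚ < (if c then v else 0ℚ) → T c × 0ℚ < v
if-pos true 0<v = _ , 0<v
if-pos false 0<0 = contradiction 0<0 (<-irrefl refl)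

𝟙 : Bool → ℚ
𝟙 c = if c then 1ℚ else 0ℚ

𝟙-no : ∀ {P : Set} (P? : Dec P) → ¬ P → 𝟙 ⌊ P? ⌋ ≡ 0ℚ
𝟙-no P? ¬p = cong 𝟙 (trans (isYes≗does P?) (dec-false P? ¬p))

∑≡sum : ∀ {n} (f : Fin n → ℚ) → ∑ f ≡ sum f
∑≡sum {zero} f = refl
∑≡sum {suc n} f = cong (f zero +_) (∑≡sum (f ∘ suc))

∑-cong : ∀ {n} {f g : Fin n → ℚ} → (∀ i → f i ≡ g i) → ∑ f ≡ ∑ g
∑-cong {zero} f≗g = refl
∑-cong {suc n} f≗g = cong₂ _+_ (f≗g zero) (∑-cong (f≗g ∘ suc))

∑-zero : ∀ {n} → ∑ {n} (λ _ → 0ℚ) ≡ 0ℚ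
∑-zero {zero} = refl
∑-zero {suc n} = cong (0ℚ +_) (∑-zero {n})

∑-+ : ∀ {n} (f g : Fin n → ℚ) → ∑ (λ i → f i + g i) ≡ ∑ f + ∑ g
∑-+ f g = begin
  ∑ (λ i → f i + g i)   ≡⟨ ∑≡sum (λ i → f i + g i) ⟩
  sum (λ i → f i + g i) ≡⟨ ∑-distrib-+ f g ⟩
  sum f + sum g         ≡⟨ sym (cong₂ _+_ (∑≡sum f) (∑≡sum g)) ⟩
  ∑ f + ∑ g             ∎
  where open ≡-Reasoning

∑-*ˡ : ∀ {n} c (f : Fin n → ℚ) → ∑ (λ i → c * f i) ≡ c * ∑ f
∑-*ˡ c f = begin
  ∑ (λ i → c * f i)   ≡⟨ ∑≡sum (λ i → c * f i) ⟩
  sum (λ i → c * f i) ≡⟨ sym (*-distribˡ-sum c f) ⟩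
  c * sum f           ≡⟨ cong (c *_) (sym (∑≡sum f)) ⟩
  c * ∑ f             ∎
  where open ≡-Reasoning

∑-swap : ∀ {m n} (f : Fin m → Fin n → ℚ) →
         ∑ (λ i → ∑ (f i)) ≡ ∑ (λ j → ∑ (λ i → f i j))
∑-swap f = begin
  ∑ (λ i → ∑ (f i))                  ≡⟨ ∑-cong (∑≡sum ∘ f) ⟩
  ∑ (λ i → sum (f i))                ≡⟨ ∑≡sum (λ i → sum (f i)) ⟩
  sum (λ i → sum (f i))              ≡⟨ ∑-comm f ⟩
  sum (λ j → sum (λ i → f i j))      ≡⟨ sym (∑≡sum (λ j → sum (λ i → f i j))) ⟩
  ∑ (λ j → sum (λ i → f i j))        ≡⟨ sym (∑-cong (λ j → ∑≡sum (λ i → f i j))) ⟩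
  ∑ (λ j → ∑ (λ i → f i j))          ∎
  where open ≡-Reasoning

∑∑-+ : ∀ {m n} (f g : Fin m → Fin n → ℚ) →
        ∑ (λ i → ∑ λ j → f i j + g i j) ≡ ∑ (λ i → ∑ (f i)) + ∑ (λ i → ∑ (g i))
∑∑-+ f g = trans (∑-cong (λ i → ∑-+ (f i) (g i))) (∑-+ (λ i → ∑ (f i)) (λ i → ∑ (g i)))

∑-mono-≤ : ∀ {n} {f g : Fin n → ℚ} → (∀ i → f i ≤ g i) → ∑ f ≤ ∑ g
∑-mono-≤ {zero} f≤g = ≤-refl
∑-mono-≤ {suc n} f≤g = +-mono-≤ (f≤g zero) (∑-mono-≤ (f≤g ∘ suc))

∑-nonNeg : ∀ {n} {f : Fin n → ℚ} → (∀ i → 0ℚ ≤ f i) → 0ℚ ≤ ∑ f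
∑-nonNeg {n} {f} 0≤f = subst (_≤ ∑ f) (∑-zero {n}) (∑-mono-≤ 0≤f)

∑-mono-≤-tight : ∀ {n} {f g : Fin n → ℚ} →
                 (∀ i → f i ≤ g i) → ∑ g ≤ ∑ f → ∀ i → g i ≤ f i
∑-mono-≤-tight f≤g ∑g≤∑f zero = proj₁ (+-mono-≤-tight (f≤g zero) (∑-mono-≤ (f≤g ∘ suc)) ∑g≤∑f)
∑-mono-≤-tight f≤g ∑g≤∑f (suc i) =
  ∑-mono-≤-tight (f≤g ∘ suc) (proj₂ (+-mono-≤-tight (f≤g zero) (∑-mono-≤ (f≤g ∘ suc)) ∑g≤∑f)) i

∑-nonNeg-≤0 : ∀ {n} {f : Fin n → ℚ} →
              (∀ i → 0ℚ ≤ f i) → ∑ f ≤ 0ℚ → ∀ i → f i ≤ 0ℚ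
∑-nonNeg-≤0 {n} {f} 0≤f ∑f≤0 =
  ∑-mono-≤-tight 0≤f (subst (∑ f ≤_) (sym (∑-zero {n})) ∑f≤0)

∑-single : ∀ {n} {f : Fin n → ℚ} j → (∀ i → i ≢ j → f i ≡ 0ℚ) → ∑ f ≡ f j
∑-single {suc n} {f} zero others =
  trans (cong (f zero +_) (trans (∑-cong (λ i → others (suc i) λ ())) (∑-zero {n})))
        (+-identityʳ (f zero))
∑-single {suc n} {f} (suc j) others =
  trans (cong (_+ ∑ (f ∘ suc)) (others zero λ ()))
        (trans (+-identityˡ _) (∑-single j (λ i i≢j → others (suc i) (i≢j ∘ suc-injective))))

term≤∑ : ∀ {n} {f : Fin n → ℚ} → (∀ i → 0ℚ ≤ f i) → ∀ j → f j ≤ ∑ f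
term≤∑ 0≤f zero = p≤p+q (∑-nonNeg (0≤f ∘ suc))
term≤∑ 0≤f (suc j) = ≤-trans (term≤∑ (0≤f ∘ suc) j) (q≤p+q (0≤f zero))

∑-pos : ∀ {n} {f : Fin n → ℚ} → 0ℚ < ∑ f → ∃[ i ] 0ℚ < f i
∑-pos {n} {f} 0<∑f with any? (λ i → 0ℚ <? f i)
... | yes found = found
... | no none = contradiction (<-≤-trans 0<∑f ∑f≤0) (<-irrefl refl)
  where
  ∑f≤0 : ∑ f ≤ 0ℚ
  ∑f≤0 = subst (∑ f ≤_) (∑-zero {n}) (∑-mono-≤ (λ i → ≮⇒≥ (none ∘ (i ,_))))

∑-diagonal : ∀ {n} (f : Fin n → ℚ) j → ∑ (λ i → if ⌊ i Fin.≟ j ⌋ then f i else 0ℚ) ≡ f j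
∑-diagonal f j = trans (∑-single j off-diagonal) (cong (if_then f j else 0ℚ) diagonal)
  where
  diagonal : ⌊ j Fin.≟ j ⌋ ≡ true
  diagonal = trans (isYes≗does (j Fin.≟ j)) (dec-true (j Fin.≟ j) refl)
  off-diagonal : ∀ i → i ≢ j → (if ⌊ i Fin.≟ j ⌋ then f i else 0ℚ) ≡ 0ℚ
  off-diagonal i i≢j =
    cong (if_then f i else 0ℚ) (trans (isYes≗does (i Fin.≟ j)) (dec-false (i Fin.≟ j) i≢j))

∑-indicator-≤1 : ∀ {n} (e c : Fin n → Bool) → (∀ i j → T (c i) → T (c j) → i ≡ j) →
                 ∑ (λ i → if e i then 𝟙 (c i) else 0ℚ) ≤ 1ℚ
∑-indicator-≤1 {n} e c unique with any? (λ i → T? (c i))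
... | yes (j , cj) =
  subst (_≤ 1ℚ)
    (sym (∑-single j λ i i≢j → if-vanish (e i) (if-¬T (i≢j ∘ λ ci → unique i j ci cj))))
    (≤-trans (if-≤ (e j) (if-nonNeg (c j) 0≤1)) (≤-reflexive (if-T cj)))
... | no none =
  subst (_≤ 1ℚ)
    (sym (trans (∑-cong λ i → if-vanish (e i) (if-¬T (none ∘ (i ,_)))) (∑-zero {n}))) 0≤1

module _ {n} {P : Fin n → Set} (P? : Decidable P) (f : Fin n → ℚ) where
  private
    open Data.List.Extrema (DecTotalOrder.totalOrder ≤-decTotalOrder)
      using (argmin; argmax; argmin-all; argmax-all; f[argmin]≤f[xs]; f[xs]≤f[argmax])
    candidates : List (Fin n)
    candidates = filter P? (allFin n)
    candidate : ∀ {i} → P i → i ∈ candidates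
    candidate {i} = ∈-filter⁺ P? (∈-allFin i)

  minimiser : ∃[ i ] P i → ∃[ j ] P j × (∀ l → P l → f j ≤ f l)
  minimiser (i , Pi) =
    argmin f i candidates , argmin-all f Pi (all-filter P? (allFin n)) ,
    λ l Pl → lookup (f[argmin]≤f[xs] {f = f} i candidates) (candidate Pl)

  maximiser : ∃[ i ] P i → ∃[ j ] P j × (∀ l → P l → f l ≤ f j)
  maximiser (i , Pi) =
    argmax f i candidates , argmax-all f Pi (all-filter P? (allFin n)) ,
    λ l Pl → lookup (f[xs]≤f[argmax] {f = f} i candidates) (candidate Pl)

-- Mass above an element of a weighted strict partial order

module StrictOrderMass {n} (R : Fin n → Fin n → Bool)
  (R-irrefl : ∀ i → ¬ T (R i i)) (R-trans : ∀ i j l → T (R i j) → T (R j l) → T (R i l))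
  (w : Fin n → ℚ) where

  above : Fin n → ℚ
  above b = ∑ λ i → if R i b then w i else 0ℚ

  atOrAbove-elim : ∀ {i b} → T (R i b ∨ ⌊ i Fin.≟ b ⌋) → T (R i b) ⊎ i ≡ b
  atOrAbove-elim = map₂ toWitness ∘ Equivalence.to T-∨

  atOrAbove-intro : ∀ {i b} → T (R i b) ⊎ i ≡ b → T (R i b ∨ ⌊ i Fin.≟ b ⌋)
  atOrAbove-intro = Equivalence.from T-∨ ∘ map₂ fromWitness

  above+w≡∑ : ∀ b → above b + w b ≡ ∑ λ i → if R i b ∨ ⌊ i Fin.≟ b ⌋ then w i else 0ℚ
  above+w≡∑ b = begin
    above b + w b
      ≡⟨ cong (above b +_) (sym (∑-diagonal w b)) ⟩
    above b + ∑ (λ i → if ⌊ i Fin.≟ b ⌋ then w i else 0ℚ)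
      ≡⟨ sym (∑-+ (λ i → if R i b then w i else 0ℚ)
                  (λ i → if ⌊ i Fin.≟ b ⌋ then w i else 0ℚ)) ⟩
    ∑ (λ i → (if R i b then w i else 0ℚ) + (if ⌊ i Fin.≟ b ⌋ then w i else 0ℚ))
      ≡⟨ ∑-cong disjoint-masks ⟩
    ∑ (λ i → if R i b ∨ ⌊ i Fin.≟ b ⌋ then w i else 0ℚ) ∎
    where
    open ≡-Reasoning
    disjoint-masks : ∀ i → (if R i b then w i else 0ℚ) + (if ⌊ i Fin.≟ b ⌋ then w i else 0ℚ)
                         ≡ (if R i b ∨ ⌊ i Fin.≟ b ⌋ then w i else 0ℚ)
    disjoint-masks i with R i b in Rib | i Fin.≟ b
    ... | true  | yes refl = contradiction (Equivalence.from T-≡ Rib) (R-irrefl i)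
    ... | true  | no _     = +-identityʳ (w i)
    ... | false | yes refl = +-identityˡ (w i)
    ... | false | no _     = refl

  incomparable : Fin n → Fin n → Bool
  incomparable i b = not (R i b ∨ ⌊ i Fin.≟ b ⌋ ∨ R b i)

  incomparableMass : ℚ
  incomparableMass = ∑ λ b → ∑ λ i → if incomparable i b then w b * w i else 0ℚ

  private
    above-only : ∀ p q → p * q ≡ p * q + q * 0ℚ + 0ℚ
    above-only = solve-∀ ℚ-ring
    below-only : ∀ p q → p * q ≡ p * 0ℚ + q * p + 0ℚ
    below-only = solve-∀ ℚ-ring
    neither : ∀ p q → p * q ≡ p * 0ℚ + q * 0ℚ + p * q
    neither = solve-∀ ℚ-ring

  product-split : ∀ b i → w b * w i ≡
    w b * (if R i b ∨ ⌊ i Fin.≟ b ⌋ then w i else 0ℚ) + w i * (if R b i then w b else 0ℚ)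
      + (if incomparable i b then w b * w i else 0ℚ)
  product-split b i with R i b in Rib | i Fin.≟ b | R b i in Rbi
  ... | true  | _        | true  =
        contradiction (R-trans i b i (Equivalence.from T-≡ Rib) (Equivalence.from T-≡ Rbi)) (R-irrefl i)
  ... | true  | _        | false = above-only (w b) (w i)
  ... | false | yes refl | true  = contradiction (Equivalence.from T-≡ Rbi) (R-irrefl b)
  ... | false | yes refl | false = above-only (w b) (w i)
  ... | false | no _     | true  = below-only (w b) (w i)
  ... | false | no _     | false = neither (w b) (w i)

  ∑-square : ∑ w * ∑ w ≡ ∑ (λ b → w b * (above b + above b + w b)) + incomparableMass
  ∑-square = begin
    ∑ w * ∑ w
      ≡⟨ sym (∑-*ˡ (∑ w) w) ⟩
    ∑ (λ b → ∑ w * w b)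
      ≡⟨ ∑-cong (λ b → trans (*-comm (∑ w) (w b)) (sym (∑-*ˡ (w b) w))) ⟩
    ∑ (λ b → ∑ λ i → w b * w i)
      ≡⟨ ∑-cong (λ b → ∑-cong (product-split b)) ⟩
    ∑ (λ b → ∑ λ i → X b i + Y b i + Z b i)
      ≡⟨ ∑∑-+ (λ b i → X b i + Y b i) Z ⟩
    ∑ (λ b → ∑ λ i → X b i + Y b i) + incomparableMass
      ≡⟨ cong (_+ incomparableMass) (∑∑-+ X Y) ⟩
    ∑ (λ b → ∑ (X b)) + ∑ (λ b → ∑ (Y b)) + incomparableMass
      ≡⟨ cong₂ (λ p q → p + q + incomparableMass) ∑∑X ∑∑Y ⟩
    ∑ (λ b → w b * (above b + w b)) + ∑ (λ b → w b * above b) + incomparableMass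
      ≡⟨ cong (_+ incomparableMass)
              (sym (∑-+ (λ b → w b * (above b + w b)) (λ b → w b * above b))) ⟩
    ∑ (λ b → w b * (above b + w b) + w b * above b) + incomparableMass
      ≡⟨ cong (_+ incomparableMass) (∑-cong (λ b → regroup (w b) (above b))) ⟩
    ∑ (λ b → w b * (above b + above b + w b)) + incomparableMass ∎
    where
    open ≡-Reasoning
    X Y Z : Fin n → Fin n → ℚ
    X b i = w b * (if R i b ∨ ⌊ i Fin.≟ b ⌋ then w i else 0ℚ)
    Y b i = w i * (if R b i then w b else 0ℚ)
    Z b i = if incomparable i b then w b * w i else 0ℚ
    ∑∑X : ∑ (λ b → ∑ (X b)) ≡ ∑ (λ b → w b * (above b + w b))
    ∑∑X = ∑-cong λ b → trans (∑-*ˡ (w b) (λ i → if R i b ∨ ⌊ i Fin.≟ b ⌋ then w i else 0ℚ))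
                             (cong (w b *_) (sym (above+w≡∑ b)))
    ∑∑Y : ∑ (λ b → ∑ (Y b)) ≡ ∑ (λ b → w b * above b)
    ∑∑Y = trans (∑-swap Y) (∑-cong λ i → ∑-*ˡ (w i) (λ b → if R b i then w b else 0ℚ))
    regroup : ∀ p a → p * (a + p) + p * a ≡ p * (a + a + p)
    regroup = solve-∀ ℚ-ring

  incomparableMass-nonNeg : (∀ i → 0ℚ ≤ w i) → 0ℚ ≤ incomparableMass
  incomparableMass-nonNeg 0≤w =
    ∑-nonNeg λ b → ∑-nonNeg λ i → if-nonNeg (incomparable i b) (*-nonNeg (0≤w b) (0≤w i))

  SupportIsChain : Set
  SupportIsChain = ∀ i j → i ≢ j → 0ℚ < w i → 0ℚ < w j → T (R i j) ⊎ T (R j i)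

  support-chain : (∀ i → 0ℚ ≤ w i) → incomparableMass ≤ 0ℚ → SupportIsChain
  support-chain 0≤w mass≤0 i j i≢j 0<wi 0<wj = comparable (term≤0 j i)
    where
    term-nonNeg : ∀ b i → 0ℚ ≤ (if incomparable i b then w b * w i else 0ℚ)
    term-nonNeg b i = if-nonNeg (incomparable i b) (*-nonNeg (0≤w b) (0≤w i))
    term≤0 : ∀ b i → (if incomparable i b then w b * w i else 0ℚ) ≤ 0ℚ
    term≤0 b = ∑-nonNeg-≤0 (term-nonNeg b) (∑-nonNeg-≤0 (λ b → ∑-nonNeg (term-nonNeg b)) mass≤0 b)
    comparable : (if incomparable i j then w j * w i else 0ℚ) ≤ 0ℚ →
                 T (R i j) ⊎ T (R j i)
    comparable term≤0 with R i j | i Fin.≟ j | R j i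
    ... | true  | _       | _     = inj₁ _
    ... | false | _       | true  = inj₂ _
    ... | false | yes i≡j | false = contradiction i≡j i≢j
    ... | false | no _    | false = contradiction (*-pos 0<wj 0<wi) (≤⇒≯ term≤0)

  module _ (0≤w : ∀ i → 0ℚ ≤ w i) where

    above-nonNeg : ∀ b → 0ℚ ≤ above b
    above-nonNeg b = ∑-nonNeg λ i → if-nonNeg (R i b) (0≤w i)

    above+w≤∑ : ∀ b → above b + w b ≤ ∑ w
    above+w≤∑ b =
      subst (_≤ ∑ w) (sym (above+w≡∑ b))
        (∑-mono-≤ λ i → if-≤ (R i b ∨ ⌊ i Fin.≟ b ⌋) (0≤w i))

    above-mono : ∀ {i j} → T (R i j) → above i + w i ≤ above j
    above-mono {i} {j} Rij =
      subst (_≤ above j) (sym (above+w≡∑ i)) (∑-mono-≤ λ l → if-mono (below l) (0≤w l))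
      where
      below : ∀ l → T (R l i ∨ ⌊ l Fin.≟ i ⌋) → T (R l j)
      below l = [ (λ Rli → R-trans l i j Rli Rij) , (λ { refl → Rij }) ] ∘ atOrAbove-elim

    module _ (chain : SupportIsChain) where

      separated : ∀ i j → i ≢ j → 0ℚ < w i → 0ℚ < w j →
                  above i + w i ≤ above j ⊎ above j + w j ≤ above i
      separated i j i≢j 0<wi 0<wj = Sum.map above-mono above-mono (chain i j i≢j 0<wi 0<wj)

      predecessor : ∀ b → 0ℚ < above b → ∃[ i ] T (R i b) × 0ℚ < w i × above i + w i ≡ above b
      predecessor b 0<above = closest (maximiser above? above first)
        where
        Above : Fin n → Set
        Above l = T (R l b) × 0ℚ < w l
        above? : Decidable Above
        above? l = T? (R l b) ×-dec (0ℚ <? w l)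
        first : ∃[ l ] Above l
        first = let l , 0<term = ∑-pos 0<above in l , if-pos (R l b) 0<term
        closest : ∃[ i ] Above i × (∀ l → Above l → above l ≤ above i) →
                  ∃[ i ] T (R i b) × 0ℚ < w i × above i + w i ≡ above b
        closest (i , (Rib , 0<wi) , maximal) =
          i , Rib , 0<wi , trans (above+w≡∑ i) (sym (∑-cong same-mask))
          where
          same-mask : ∀ l → (if R l b then w l else 0ℚ)
                          ≡ (if R l i ∨ ⌊ l Fin.≟ i ⌋ then w l else 0ℚ)
          same-mask l with 0ℚ <? w l
          ... | no ¬0<wl =
                trans (if-vanish (R l b) wl≡0) (sym (if-vanish (R l i ∨ ⌊ l Fin.≟ i ⌋) wl≡0))
            where
            wl≡0 = ≤-antisym (≮⇒≥ ¬0<wl) (0≤w l)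
          ... | yes 0<wl = if-cong down up
            where
            up : T (R l i ∨ ⌊ l Fin.≟ i ⌋) → T (R l b)
            up = [ (λ Rli → R-trans l i b Rli Rib) , (λ { refl → Rib }) ] ∘ atOrAbove-elim
            down : T (R l b) → T (R l i ∨ ⌊ l Fin.≟ i ⌋)
            down = atOrAbove-intro ∘ above-or-equal
              where
              above-or-equal : T (R l b) → T (R l i) ⊎ l ≡ i
              above-or-equal Rlb with l Fin.≟ i
              ... | yes l≡i = inj₂ l≡i
              ... | no l≢i with chain l i l≢i 0<wl 0<wi
              ...   | inj₁ Rli = inj₁ Rli
              ...   | inj₂ Ril = contradiction (p<p+q 0<wi)
                                   (≤⇒≯ (≤-trans (above-mono Ril) (maximal l (Rlb , 0<wl))))

      -- The intervals [above i , above i + w i ⟩ of the support above b tile [0 , above b ⟩, so a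
      -- decidable Q that fails at 0 and holds at above b switches on at the top of one of them.
      crossing : ∀ {Q : ℚ → Set} → (∀ v → Dec (Q v)) → ¬ Q 0ℚ → ∀ b → Q (above b) →
                 ∃[ i ] T (R i b) × 0ℚ < w i × ¬ Q (above i) × Q (above i + w i)
      crossing {Q} Q? ¬Q0 b Qb = cross (minimiser crosses? (λ l → above l + w l) first)
        where
        Crosses : Fin n → Set
        Crosses l = T (R l b) × 0ℚ < w l × Q (above l + w l)
        crosses? : Decidable Crosses
        crosses? l = T? (R l b) ×-dec (0ℚ <? w l) ×-dec Q? (above l + w l)
        first : ∃[ i ] Crosses i
        first = let i , Rib , 0<wi , top≡ = predecessor b (pos-unless-zero {Q = Q} ¬Q0 (above-nonNeg b) Qb)
                in i , Rib , 0<wi , subst Q (sym top≡) Qb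
        cross : ∃[ i ] Crosses i × (∀ l → Crosses l → above i + w i ≤ above l + w l) →
                ∃[ i ] T (R i b) × 0ℚ < w i × ¬ Q (above i) × Q (above i + w i)
        cross (i , (Rib , 0<wi , Qtop) , minimal) = i , Rib , 0<wi , ¬Qbottom , Qtop
          where
          ¬Qbottom : ¬ Q (above i)
          ¬Qbottom Qi =
            let j , Rji , 0<wj , top≡ = predecessor i (pos-unless-zero {Q = Q} ¬Q0 (above-nonNeg i) Qi)
            in contradiction (p<p+q 0<wi) (≤⇒≯ (subst (above i + w i ≤_) top≡
                 (minimal j (R-trans j i b Rji Rib , 0<wj , subst Q (sym top≡) Qi))))

-- Half-open intervals and left Riemann sums

_∈[_,_⟩ : ℚ → ℚ → ℚ → Set
s ∈[ lo , hi ⟩ = lo ≤ s × s < hi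

_∈?[_,_⟩ : ∀ s lo hi → Dec (s ∈[ lo , hi ⟩)
s ∈?[ lo , hi ⟩ = (lo ≤? s) ×-dec (s <? hi)

UnitInterval : ℚ → Set
UnitInterval s = 0ℚ ≤ s × s ≤ 1ℚ

interval-width-pos : ∀ {s lo w} → s ∈[ lo , lo + w ⟩ → 0ℚ < w
interval-width-pos {lo = lo} {w} (lo≤s , s<lo+w) =
  <-fromDiff (cancel lo w) (p<q⇒0<q-p (≤-<-trans lo≤s s<lo+w))
  where
  cancel : ∀ lo w → w - 0ℚ ≡ lo + w - lo
  cancel = solve-∀ ℚ-ring

interval-unique : ∀ {n} (lo w : Fin n → ℚ) →
                  (∀ i j → i ≢ j → 0ℚ < w i → 0ℚ < w j →
                     lo i + w i ≤ lo j ⊎ lo j + w j ≤ lo i) →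
                  ∀ {s} i j → s ∈[ lo i , lo i + w i ⟩ → s ∈[ lo j , lo j + w j ⟩ → i ≡ j
interval-unique lo w separated i j s∈i s∈j with i Fin.≟ j
... | yes i≡j = i≡j
... | no i≢j =
  contradiction (separated i j i≢j (interval-width-pos s∈i) (interval-width-pos s∈j)) disjoint
  where
  disjoint : ¬ (lo i + w i ≤ lo j ⊎ lo j + w j ≤ lo i)
  disjoint (inj₁ i≤j) = ≤⇒≯ (≤-trans i≤j (proj₁ s∈j)) (proj₂ s∈i)
  disjoint (inj₂ j≤i) = ≤⇒≯ (≤-trans j≤i (proj₁ s∈i)) (proj₂ s∈j)

𝟙-interval : ∀ {lo hi} s → lo ≤ hi → 𝟙 ⌊ s ∈?[ lo , hi ⟩ ⌋ ≡ 𝟙 ⌊ s <? hi ⌋ - 𝟙 ⌊ s <? lo ⌋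
𝟙-interval {lo} {hi} s lo≤hi with lo ≤? s | s <? hi | s <? lo
... | yes lo≤s | _       | yes s<lo = contradiction s<lo (≤⇒≯ lo≤s)
... | yes _    | yes _   | no _     = refl
... | yes _    | no _    | no _     = refl
... | no lo≰s  | _       | no s≮lo  = contradiction (≰⇒> lo≰s) s≮lo
... | no _     | yes _   | yes _    = refl
... | no _     | no s≮hi | yes s<lo = contradiction (<-≤-trans s<lo lo≤hi) s≮hi

Sorted : List ℚ → Set
Sorted = Linked _≤_

sorted-head : ∀ {t ts y} → Sorted (t ∷ ts) → y ∈ t ∷ ts → t ≤ y
sorted-head sorted = lookup (Linked⇒All ≤-trans ≤-refl sorted)

final : ℚ → List ℚ → ℚ
final t [] = t
final _ (t' ∷ ts) = final t' ts

≤-final : ∀ {t ts y} → Sorted (t ∷ ts) → y ∈ t ∷ ts → y ≤ final t ts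
≤-final {ts = []} _ (here refl) = ≤-refl
≤-final {ts = _ ∷ _} (t≤t' ∷ sorted) (here refl) = ≤-trans t≤t' (≤-final sorted (here refl))
≤-final {ts = _ ∷ _} (_ ∷ sorted) (there y∈) = ≤-final sorted y∈

All-final : ∀ {P : ℚ → Set} {t} ts → All P (t ∷ ts) → P (final t ts)
All-final [] (Pt ∷ []) = Pt
All-final (_ ∷ ts) (_ ∷ Pts) = All-final ts Pts

riemann : (ℚ → ℚ) → ℚ → List ℚ → ℚ
riemann f t [] = 0ℚ
riemann f t (t' ∷ ts) = (t' - t) * f t + riemann f t' ts

riemann-cong : ∀ {f g} → (∀ s → f s ≡ g s) → ∀ t ts → riemann f t ts ≡ riemann g t ts
riemann-cong f≗g t [] = refl
riemann-cong f≗g t (t' ∷ ts) = cong₂ (λ v r → (t' - t) * v + r) (f≗g t) (riemann-cong f≗g t' ts)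

riemann-- : ∀ f g t ts → riemann (λ s → f s - g s) t ts ≡ riemann f t ts - riemann g t ts
riemann-- f g t [] = refl
riemann-- f g t (t' ∷ ts) =
  trans (cong ((t' - t) * (f t - g t) +_) (riemann-- f g t' ts))
        (distribute (t' - t) (f t) (g t) (riemann f t' ts) (riemann g t' ts))
  where
  distribute : ∀ d a b r r' → d * (a - b) + (r - r') ≡ (d * a + r) - (d * b + r')
  distribute = solve-∀ ℚ-ring

riemann-one : ∀ t ts → riemann (λ _ → 1ℚ) t ts ≡ final t ts - t
riemann-one t [] = sym (+-inverseʳ t)
riemann-one t (t' ∷ ts) =
  trans (cong ((t' - t) * 1ℚ +_) (riemann-one t' ts)) (telescope t t' (final t' ts))
  where
  telescope : ∀ t t' l → (t' - t) * 1ℚ + (l - t') ≡ l - t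
  telescope = solve-∀ ℚ-ring

riemann-below : ∀ {q t} ts → q ≤ t → Sorted (t ∷ ts) →
                riemann (λ s → 𝟙 ⌊ s <? q ⌋) t ts ≡ 0ℚ
riemann-below [] _ _ = refl
riemann-below {q} {t} (t' ∷ ts) q≤t (t≤t' ∷ sorted) =
  trans (cong₂ (λ v r → (t' - t) * v + r) (𝟙-no (t <? q) (≤⇒≯ q≤t))
                                           (riemann-below ts (≤-trans q≤t t≤t') sorted))
        (vanish (t' - t))
  where
  vanish : ∀ d → d * 0ℚ + 0ℚ ≡ 0ℚ
  vanish = solve-∀ ℚ-ring

riemann-< : ∀ {q t} ts → Sorted (t ∷ ts) → q ∈ t ∷ ts →
            riemann (λ s → 𝟙 ⌊ s <? q ⌋) t ts ≡ q - t
riemann-< {t = t} ts sorted (here refl) = trans (riemann-below ts ≤-refl sorted) (sym (+-inverseʳ t))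
riemann-< {q} {t} (t' ∷ ts) (t≤t' ∷ sorted) (there q∈) =
  trans (cong₂ _+_ step (riemann-< ts sorted q∈)) (telescope t t' q)
  where
  t'≤q = sorted-head sorted q∈
  step : (t' - t) * 𝟙 ⌊ t <? q ⌋ ≡ t' - t
  step with t <? q
  ... | yes _ = *-identityʳ (t' - t)
  ... | no t≮q = trans (*-zeroʳ (t' - t)) (sym (trans (cong (_- t) t'≡t) (+-inverseʳ t)))
    where
    t'≡t = ≤-antisym (≤-trans t'≤q (≮⇒≥ t≮q)) t≤t'
  telescope : ∀ t t' q → (t' - t) + (q - t') ≡ q - t
  telescope = solve-∀ ℚ-ring

riemann-interval : ∀ {lo hi t} ts → lo ≤ hi → Sorted (t ∷ ts) → lo ∈ t ∷ ts → hi ∈ t ∷ ts →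
                   riemann (λ s → 𝟙 ⌊ s ∈?[ lo , hi ⟩ ⌋) t ts ≡ hi - lo
riemann-interval {lo} {hi} {t} ts lo≤hi sorted lo∈ hi∈ = begin
  riemann (λ s → 𝟙 ⌊ s ∈?[ lo , hi ⟩ ⌋) t ts
    ≡⟨ riemann-cong (λ s → 𝟙-interval s lo≤hi) t ts ⟩
  riemann (λ s → 𝟙 ⌊ s <? hi ⌋ - 𝟙 ⌊ s <? lo ⌋) t ts
    ≡⟨ riemann-- (λ s → 𝟙 ⌊ s <? hi ⌋) (λ s → 𝟙 ⌊ s <? lo ⌋) t ts ⟩
  riemann (λ s → 𝟙 ⌊ s <? hi ⌋) t ts - riemann (λ s → 𝟙 ⌊ s <? lo ⌋) t ts
    ≡⟨ cong₂ _-_ (riemann-< ts sorted hi∈) (riemann-< ts sorted lo∈) ⟩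
  (hi - t) - (lo - t)
    ≡⟨ cancel hi lo t ⟩
  hi - lo ∎
  where
  open ≡-Reasoning
  cancel : ∀ hi lo t → (hi - t) - (lo - t) ≡ hi - lo
  cancel = solve-∀ ℚ-ring

module _ {m k : ℕ} (G : PrefGraph m k) where
  open PrefGraph G

  -- Convex combinations of super-stable matchings satisfy the constraints

  Functional : Set
  Functional = (Fin m → Fin k → ℚ) → ℚ

  record IsLinear (ℓ : Functional) : Set where
    field
      cong-pointwise : ∀ {y z} → (∀ a b → y a b ≡ z a b) → ℓ y ≡ ℓ z
      at-zero : ℓ (λ _ _ → 0ℚ) ≡ 0ℚ
      affine : ∀ u y z → ℓ (λ a b → u * y a b + z a b) ≡ u * ℓ y + ℓ z

  open IsLinear

  eval-linear : ∀ a b → IsLinear (λ y → y a b)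
  eval-linear a b = record
    { cong-pointwise = λ y≗z → y≗z a b ; at-zero = refl ; affine = λ _ _ _ → refl }

  if-linear : ∀ c {ℓ} → IsLinear ℓ → IsLinear (λ y → if c then ℓ y else 0ℚ)
  if-linear true ℓ-lin = ℓ-lin
  if-linear false _ = record
    { cong-pointwise = λ _ → refl ; at-zero = refl ; affine = λ u _ _ → sym (u*0+0≡0 u) }
    where
    u*0+0≡0 : ∀ u → u * 0ℚ + 0ℚ ≡ 0ℚ
    u*0+0≡0 = solve-∀ ℚ-ring

  +-linear : ∀ {ℓ ℓ'} → IsLinear ℓ → IsLinear ℓ' → IsLinear (λ y → ℓ y + ℓ' y)
  +-linear {ℓ} {ℓ'} ℓ-lin ℓ'-lin = record
    { cong-pointwise = λ y≗z → cong₂ _+_ (cong-pointwise ℓ-lin y≗z) (cong-pointwise ℓ'-lin y≗z)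
    ; at-zero = cong₂ _+_ (at-zero ℓ-lin) (at-zero ℓ'-lin)
    ; affine = λ u y z → trans (cong₂ _+_ (affine ℓ-lin u y z) (affine ℓ'-lin u y z))
                               (interchange u (ℓ y) (ℓ z) (ℓ' y) (ℓ' z))
    }
    where
    interchange : ∀ u a b c d → (u * a + b) + (u * c + d) ≡ u * (a + c) + (b + d)
    interchange = solve-∀ ℚ-ring

  ∑-linear : ∀ {n} {ℓ : Fin n → Functional} →
             (∀ i → IsLinear (ℓ i)) → IsLinear (λ y → ∑ λ i → ℓ i y)
  ∑-linear {n} {ℓ} ℓ-lin = record
    { cong-pointwise = λ y≗z → ∑-cong λ i → cong-pointwise (ℓ-lin i) y≗z
    ; at-zero = trans (∑-cong (at-zero ∘ ℓ-lin)) (∑-zero {n})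
    ; affine = λ u y z → trans (∑-cong λ i → affine (ℓ-lin i) u y z)
                          (trans (∑-+ (λ i → u * ℓ i y) (λ i → ℓ i z))
                                 (cong (_+ ∑ λ i → ℓ i z) (∑-*ˡ u (λ i → ℓ i y))))
    }

  degreeˡ : Fin m → Functional
  degreeˡ a y = ∑ λ b → if adj a b then y a b else 0ℚ

  degreeʳ : Fin k → Functional
  degreeʳ b y = ∑ λ a → if adj a b then y a b else 0ℚ

  dominance : Fin m → Fin k → Functional
  dominance a b y = (∑ (λ i → if adj a i then (if prefL a i b then y a i else 0ℚ) else 0ℚ)
                   + ∑ (λ j → if adj j b then (if prefR b j a then y j b else 0ℚ) else 0ℚ))
                   + y a b

  degreeˡ-linear : ∀ a → IsLinear (degreeˡ a)
  degreeˡ-linear a = ∑-linear λ b → if-linear (adj a b) (eval-linear a b)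

  degreeʳ-linear : ∀ b → IsLinear (degreeʳ b)
  degreeʳ-linear b = ∑-linear λ a → if-linear (adj a b) (eval-linear a b)

  dominance-linear : ∀ a b → IsLinear (dominance a b)
  dominance-linear a b =
    +-linear (+-linear (∑-linear λ i → if-linear (adj a i) (if-linear (prefL a i b) (eval-linear a i)))
                       (∑-linear λ j → if-linear (adj j b) (if-linear (prefR b j a) (eval-linear j b))))
             (eval-linear a b)

  Good : ℚ × EdgeSet G → Set
  Good (λ₀ , M) = 0ℚ ≤ λ₀ × IsSuperStable G M

  module _ {ℓ} (ℓ-lin : IsLinear ℓ) {c : ℚ} where

    convex-≤ : (∀ M → IsSuperStable G M → ℓ (χ G M) ≤ c) →
               ∀ ps → All Good ps → ℓ (combo G ps) ≤ c * weightSum G ps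
    convex-≤ bound [] [] = ≤-reflexive (trans (at-zero ℓ-lin) (sym (*-zeroʳ c)))
    convex-≤ bound ((λ₀ , M) ∷ ps) ((0≤λ₀ , M-ss) ∷ good) =
      ≤-fromDiff
        (trans (cong (λ v → c * (λ₀ + weightSum G ps) - v) (affine ℓ-lin λ₀ (χ G M) (combo G ps)))
               (regroup c λ₀ (weightSum G ps) (ℓ (χ G M)) (ℓ (combo G ps))))
        (+-nonNeg (*-nonNeg 0≤λ₀ (p≤q⇒0≤q-p (bound M M-ss))) (p≤q⇒0≤q-p (convex-≤ bound ps good)))
      where
      regroup : ∀ c l W a r → c * (l + W) - (l * a + r) ≡ l * (c - a) + (c * W - r)
      regroup = solve-∀ ℚ-ring

    convex-≥ : (∀ M → IsSuperStable G M → c ≤ ℓ (χ G M)) →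
               ∀ ps → All Good ps → c * weightSum G ps ≤ ℓ (combo G ps)
    convex-≥ bound [] [] = ≤-reflexive (trans (*-zeroʳ c) (sym (at-zero ℓ-lin)))
    convex-≥ bound ((λ₀ , M) ∷ ps) ((0≤λ₀ , M-ss) ∷ good) =
      ≤-fromDiff
        (trans (cong (_- c * (λ₀ + weightSum G ps)) (affine ℓ-lin λ₀ (χ G M) (combo G ps)))
               (regroup c λ₀ (weightSum G ps) (ℓ (χ G M)) (ℓ (combo G ps))))
        (+-nonNeg (*-nonNeg 0≤λ₀ (p≤q⇒0≤q-p (bound M M-ss))) (p≤q⇒0≤q-p (convex-≥ bound ps good)))
      where
      regroup : ∀ c l W a r → (l * a + r) - c * (l + W) ≡ l * (a - c) + (r - c * W)
      regroup = solve-∀ ℚ-ring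

  dominated : ∀ {M a b} → IsSuperStable G M → T (adj a b) → ¬ T (M a b) →
              (∃[ b' ] T (M a b') × T (prefL a b' b)) ⊎ (∃[ a' ] T (M a' b) × T (prefR b a' a))
  dominated {M} {a} {b} (_ , unblocked) adj-ab ¬Mab
    with any? (λ b' → T? (M a b') ×-dec T? (prefL a b' b))
       | any? (λ a' → T? (M a' b) ×-dec T? (prefR b a' a))
  ... | yes better  | _           = inj₁ better
  ... | no _        | yes better  = inj₂ better
  ... | no ¬betterˡ | no ¬betterʳ = contradiction
        (adj-ab , ¬Mab , (λ b' Mab' b'>b → ¬betterˡ (b' , Mab' , b'>b))
                       , (λ a' Ma'b a'>a → ¬betterʳ (a' , Ma'b , a'>a)))
        (unblocked a b)

  χ-dominance : ∀ {M a b} → IsSuperStable G M → T (adj a b) → 1ℚ ≤ dominance a b (χ G M)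
  χ-dominance {M} {a} {b} M-ss@((M⊆E , _ , _) , _) adj-ab =
    ≤-some-summand (∑-nonNeg betterˡ-nonNeg) (∑-nonNeg betterʳ-nonNeg) (if-nonNeg (M a b) 0≤1)
                   one-summand
    where
    betterˡ : Fin k → ℚ
    betterˡ i = if adj a i then (if prefL a i b then χ G M a i else 0ℚ) else 0ℚ
    betterʳ : Fin m → ℚ
    betterʳ j = if adj j b then (if prefR b j a then χ G M j b else 0ℚ) else 0ℚ
    betterˡ-nonNeg : ∀ i → 0ℚ ≤ betterˡ i
    betterˡ-nonNeg i = if-nonNeg (adj a i) (if-nonNeg (prefL a i b) (if-nonNeg (M a i) 0≤1))
    betterʳ-nonNeg : ∀ j → 0ℚ ≤ betterʳ j
    betterʳ-nonNeg j = if-nonNeg (adj j b) (if-nonNeg (prefR b j a) (if-nonNeg (M j b) 0≤1))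
    one-summand : 1ℚ ≤ ∑ betterˡ ⊎ 1ℚ ≤ ∑ betterʳ ⊎ 1ℚ ≤ χ G M a b
    one-summand with T? (M a b)
    ... | yes Mab = inj₂ (inj₂ (≤-reflexive (sym (if-T Mab))))
    ... | no ¬Mab with dominated M-ss adj-ab ¬Mab
    ...   | inj₁ (b' , Mab' , b'>b) = inj₁ (≤-trans
            (≤-reflexive (sym (trans (if-T (M⊆E a b' Mab')) (trans (if-T b'>b) (if-T Mab')))))
            (term≤∑ betterˡ-nonNeg b'))
    ...   | inj₂ (a' , Ma'b , a'>a) = inj₂ (inj₁ (≤-trans
            (≤-reflexive (sym (trans (if-T (M⊆E a' b Ma'b)) (trans (if-T a'>a) (if-T Ma'b)))))
            (term≤∑ betterʳ-nonNeg a')))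

  hull⊆polytope : ∀ x → InSuperStableHull G x → InPolytope G x
  hull⊆polytope x (ps , good , ∑λ≡1 , x≡combo) =
    (λ a → upper (degreeˡ-linear a) λ M ((_ , unique , _) , _) →
             ∑-indicator-≤1 (adj a) (M a) (unique a)) ,
    (λ b → upper (degreeʳ-linear b) λ M ((_ , _ , unique) , _) →
             ∑-indicator-≤1 (λ a → adj a b) (λ a → M a b) (λ a a' → unique a a' b)) ,
    (λ a b adj-ab → lower (dominance-linear a b) λ M M-ss → χ-dominance M-ss adj-ab) ,
    (λ a b _ → lower (eval-linear a b) λ M _ → if-nonNeg (M a b) 0≤1)
    where
    total : ∀ c → c * weightSum G ps ≡ c
    total c = trans (cong (c *_) ∑λ≡1) (*-identityʳ c)
    upper : ∀ {ℓ c} → IsLinear ℓ → (∀ M → IsSuperStable G M → ℓ (χ G M) ≤ c) → ℓ x ≤ c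
    upper {c = c} ℓ-lin bound =
      subst₂ _≤_ (sym (cong-pointwise ℓ-lin x≡combo)) (total c) (convex-≤ ℓ-lin bound ps good)
    lower : ∀ {ℓ c} → IsLinear ℓ → (∀ M → IsSuperStable G M → c ≤ ℓ (χ G M)) → c ≤ ℓ x
    lower {c = c} ℓ-lin bound =
      subst₂ _≤_ (total c) (sym (cong-pointwise ℓ-lin x≡combo)) (convex-≥ ℓ-lin bound ps good)

  -- Zero-width pieces are skipped: the breakpoint 1 may repeat, and M 1 need not be super-stable.
  pieces : (ℚ → EdgeSet G) → ℚ → List ℚ → List (ℚ × EdgeSet G)
  pieces M t [] = []
  pieces M t (t' ∷ ts) with t <? t'
  ... | yes _ = (t' - t , M t) ∷ pieces M t' ts
  ... | no _ = pieces M t' ts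

  module _ (M : ℚ → EdgeSet G) where

    combo-pieces : ∀ {t} ts → Sorted (t ∷ ts) → ∀ a b →
                   combo G (pieces M t ts) a b ≡ riemann (λ s → χ G (M s) a b) t ts
    combo-pieces [] _ a b = refl
    combo-pieces {t} (t' ∷ ts) (t≤t' ∷ sorted) a b with t <? t'
    ... | yes _ = cong ((t' - t) * χ G (M t) a b +_) (combo-pieces ts sorted a b)
    ... | no t≮t' = trans (combo-pieces ts sorted a b)
                      (sym (zero-width (χ G (M t) a b) _ (≤-antisym (≮⇒≥ t≮t') t≤t')))

    weightSum-pieces : ∀ {t} ts → Sorted (t ∷ ts) →
                       weightSum G (pieces M t ts) ≡ riemann (λ _ → 1ℚ) t ts
    weightSum-pieces [] _ = refl
    weightSum-pieces {t} (t' ∷ ts) (t≤t' ∷ sorted) with t <? t'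
    ... | yes _ = cong₂ _+_ (sym (*-identityʳ (t' - t))) (weightSum-pieces ts sorted)
    ... | no t≮t' =
          trans (weightSum-pieces ts sorted) (sym (zero-width 1ℚ _ (≤-antisym (≮⇒≥ t≮t') t≤t')))

    pieces-good : (∀ {s} → 0ℚ ≤ s → s < 1ℚ → IsSuperStable G (M s)) →
                  ∀ {t} ts → All UnitInterval (t ∷ ts) → All Good (pieces M t ts)
    pieces-good _ [] _ = []
    pieces-good stable {t} (t' ∷ ts) ((0≤t , _) ∷ bounded@((_ , t'≤1) ∷ _)) with t <? t'
    ... | yes t<t' =
          (p≤q⇒0≤q-p (<⇒≤ t<t') , stable 0≤t (<-≤-trans t<t' t'≤1)) ∷
          pieces-good stable ts bounded
    ... | no _ = pieces-good stable ts bounded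

  -- Points of the polytope are convex combinations of super-stable matchings

  module Decomposition (x : Fin m → Fin k → ℚ) (x-vanishes : Vec^E G x) (x∈P : InPolytope G x) where

    module AtLeft (a : Fin m) = StrictOrderMass (prefL a) (prefL-irrefl a) (prefL-trans a) (x a)
    module AtRight (b : Fin k) = StrictOrderMass (prefR b) (prefR-irrefl b) (prefR-trans b) (λ a → x a b)

    aboveˡ : Fin m → Fin k → ℚ
    aboveˡ = AtLeft.above

    aboveʳ : Fin k → Fin m → ℚ
    aboveʳ = AtRight.above

    x-nonNeg : ∀ a b → 0ℚ ≤ x a b
    x-nonNeg a b with T? (adj a b)
    ... | yes adj-ab = proj₂ (proj₂ (proj₂ x∈P)) a b adj-ab
    ... | no ¬adj-ab = ≤-reflexive (sym (x-vanishes a b ¬adj-ab))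

    support⊆E : ∀ {a b} → 0ℚ < x a b → T (adj a b)
    support⊆E {a} {b} 0<x with T? (adj a b)
    ... | yes adj-ab = adj-ab
    ... | no ¬adj-ab = contradiction (subst (0ℚ <_) (x-vanishes a b ¬adj-ab) 0<x) (<-irrefl refl)

    degreeˡ≤1 : ∀ a → ∑ (x a) ≤ 1ℚ
    degreeˡ≤1 a = subst (_≤ 1ℚ) (∑-cong λ b → if-self (adj a b) (x-vanishes a b)) (proj₁ x∈P a)

    degreeʳ≤1 : ∀ b → ∑ (λ a → x a b) ≤ 1ℚ
    degreeʳ≤1 b =
      subst (_≤ 1ℚ) (∑-cong λ a → if-self (adj a b) (x-vanishes a b)) (proj₁ (proj₂ x∈P) b)

    dominance≥1 : ∀ {a b} → T (adj a b) → 1ℚ ≤ aboveˡ a b + aboveʳ b a + x a b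
    dominance≥1 {a} {b} adj-ab = subst (λ d → 1ℚ ≤ d + x a b)
      (cong₂ _+_ (∑-cong λ i → if-self (adj a i) (if-vanish (prefL a i b) ∘ x-vanishes a i))
                 (∑-cong λ j → if-self (adj j b) (if-vanish (prefR b j a) ∘ x-vanishes j b)))
      (proj₁ (proj₂ (proj₂ x∈P)) a b adj-ab)

    weightedDominance : Fin m → Fin k → ℚ
    weightedDominance a b = x a b * (aboveˡ a b + aboveʳ b a + x a b)

    x≤weightedDominance : ∀ a b → x a b ≤ weightedDominance a b
    x≤weightedDominance a b with T? (adj a b)
    ... | yes adj-ab =
          ≤-fromDiff (factor (x a b) _) (*-nonNeg (x-nonNeg a b) (p≤q⇒0≤q-p (dominance≥1 adj-ab)))
      where
      factor : ∀ u d → u * d - u ≡ u * (d - 1ℚ)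
      factor = solve-∀ ℚ-ring
    ... | no ¬adj-ab = ≤-reflexive (trans x≡0 (sym (trans (cong (_* d) x≡0) (*-zeroˡ d))))
      where
      x≡0 = x-vanishes a b ¬adj-ab
      d = aboveˡ a b + aboveʳ b a + x a b

    mass dominanceMass incomparability degreeSquares : ℚ
    mass = ∑ λ a → ∑ (x a)
    dominanceMass = ∑ λ a → ∑ (weightedDominance a)
    incomparability = ∑ AtLeft.incomparableMass + ∑ AtRight.incomparableMass
    degreeSquares = ∑ (λ a → ∑ (x a) * ∑ (x a)) + ∑ (λ b → ∑ (λ a → x a b) * ∑ (λ a → x a b))

    degreeSquares-expansion : degreeSquares ≡ (dominanceMass + dominanceMass) + incomparability
    degreeSquares-expansion = begin
      degreeSquares
        ≡⟨ cong₂ _+_ (∑-cong AtLeft.∑-square) (∑-cong AtRight.∑-square) ⟩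
      ∑ (λ a → ∑ (L a) + AtLeft.incomparableMass a) + ∑ (λ b → ∑ (R b) + AtRight.incomparableMass b)
        ≡⟨ cong₂ _+_ (∑-+ (λ a → ∑ (L a)) AtLeft.incomparableMass)
                     (∑-+ (λ b → ∑ (R b)) AtRight.incomparableMass) ⟩
      (∑ (λ a → ∑ (L a)) + Iˡ) + (∑ (λ b → ∑ (R b)) + Iʳ)
        ≡⟨ cong (λ r → (∑ (λ a → ∑ (L a)) + Iˡ) + (r + Iʳ)) (∑-swap R) ⟩
      (∑ (λ a → ∑ (L a)) + Iˡ) + (∑ (λ a → ∑ λ b → R b a) + Iʳ)
        ≡⟨ interchange (∑ (λ a → ∑ (L a))) Iˡ (∑ (λ a → ∑ λ b → R b a)) Iʳ ⟩
      (∑ (λ a → ∑ (L a)) + ∑ (λ a → ∑ λ b → R b a)) + incomparability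
        ≡⟨ cong (_+ incomparability) (sym (∑∑-+ L (λ a b → R b a))) ⟩
      ∑ (λ a → ∑ λ b → L a b + R b a) + incomparability
        ≡⟨ cong (_+ incomparability) (∑-cong λ a → ∑-cong λ b → halves (x a b) (aboveˡ a b) (aboveʳ b a)) ⟩
      ∑ (λ a → ∑ λ b → weightedDominance a b + weightedDominance a b) + incomparability
        ≡⟨ cong (_+ incomparability) (∑∑-+ weightedDominance weightedDominance) ⟩
      (dominanceMass + dominanceMass) + incomparability ∎
      where
      open ≡-Reasoning
      L : Fin m → Fin k → ℚ
      L a b = x a b * (aboveˡ a b + aboveˡ a b + x a b)
      R : Fin k → Fin m → ℚ
      R b a = x a b * (aboveʳ b a + aboveʳ b a + x a b)
      Iˡ = ∑ AtLeft.incomparableMass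
      Iʳ = ∑ AtRight.incomparableMass
      interchange : ∀ p q r s → (p + q) + (r + s) ≡ (p + r) + (q + s)
      interchange = solve-∀ ℚ-ring
      halves : ∀ u A C → u * (A + A + u) + u * (C + C + u) ≡ u * (A + C + u) + u * (A + C + u)
      halves = solve-∀ ℚ-ring

    degreeSquares≤2mass : degreeSquares ≤ mass + mass
    degreeSquares≤2mass = +-mono-≤
      (∑-mono-≤ λ a → square≤self (∑-nonNeg (x-nonNeg a)) (degreeˡ≤1 a))
      (subst (∑ (λ b → ∑ (λ a → x a b) * ∑ (λ a → x a b)) ≤_) (sym (∑-swap x))
        (∑-mono-≤ λ b → square≤self (∑-nonNeg λ a → x-nonNeg a b) (degreeʳ≤1 b)))

    private
      tightness : dominanceMass ≤ mass × ∑ AtLeft.incomparableMass ≤ 0ℚ × ∑ AtRight.incomparableMass ≤ 0ℚ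
      tightness = squeeze (subst (_≤ mass + mass) degreeSquares-expansion degreeSquares≤2mass)
        (∑-mono-≤ λ a → ∑-mono-≤ (x≤weightedDominance a))
        (∑-nonNeg λ a → AtLeft.incomparableMass-nonNeg a (x-nonNeg a))
        (∑-nonNeg λ b → AtRight.incomparableMass-nonNeg b (λ a → x-nonNeg a b))

    tight : ∀ {a b} → 0ℚ < x a b → aboveˡ a b + aboveʳ b a + x a b ≡ 1ℚ
    tight {a} {b} 0<x =
      ≤-antisym (*-cancelˡ-≤-pos (x a b) {{positive 0<x}} weighted≤x*1) (dominance≥1 (support⊆E 0<x))
      where
      row≤ = ∑-mono-≤-tight (λ a → ∑-mono-≤ (x≤weightedDominance a)) (proj₁ tightness) a
      weighted≤x*1 = subst (weightedDominance a b ≤_) (sym (*-identityʳ (x a b)))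
                           (∑-mono-≤-tight (x≤weightedDominance a) row≤ b)

    chainˡ : ∀ a → AtLeft.SupportIsChain a
    chainˡ a = AtLeft.support-chain a (x-nonNeg a)
      (∑-nonNeg-≤0 (λ a → AtLeft.incomparableMass-nonNeg a (x-nonNeg a)) (proj₁ (proj₂ tightness)) a)

    chainʳ : ∀ b → AtRight.SupportIsChain b
    chainʳ b = AtRight.support-chain b (λ a → x-nonNeg a b)
      (∑-nonNeg-≤0 (λ b → AtRight.incomparableMass-nonNeg b (λ a → x-nonNeg a b))
                   (proj₂ (proj₂ tightness)) b)

    tight-upper : ∀ {a b} → 0ℚ < x a b → aboveˡ a b + x a b ≡ 1ℚ - aboveʳ b a
    tight-upper {a} {b} 0<x =
      trans (regroup (aboveˡ a b) (aboveʳ b a) (x a b)) (cong (_- aboveʳ b a) (tight 0<x))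
      where
      regroup : ∀ A C u → A + u ≡ A + C + u - C
      regroup = solve-∀ ℚ-ring

    tight-lower : ∀ {a b} → 0ℚ < x a b → aboveˡ a b ≡ 1ℚ - (aboveʳ b a + x a b)
    tight-lower {a} {b} 0<x =
      trans (regroup (aboveˡ a b) (aboveʳ b a) (x a b)) (cong (_- (aboveʳ b a + x a b)) (tight 0<x))
      where
      regroup : ∀ A C u → A ≡ A + C + u - (C + u)
      regroup = solve-∀ ℚ-ring

    -- Tightness turns [aboveˡ a b , aboveˡ a b + x a b ⟩ into [1 - aboveʳ b a - x a b , 1 - aboveʳ b a ⟩.
    separatedʳ : ∀ b a a' → a ≢ a' → 0ℚ < x a b → 0ℚ < x a' b →
                 aboveˡ a b + x a b ≤ aboveˡ a' b ⊎ aboveˡ a' b + x a' b ≤ aboveˡ a b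
    separatedʳ b a a' a≢a' 0<x 0<x' = Sum.swap (Sum.map (reflect 0<x 0<x') (reflect 0<x' 0<x)
      (AtRight.separated b (λ a → x-nonNeg a b) (chainʳ b) a a' a≢a' 0<x 0<x'))
      where
      reflect : ∀ {a a'} → 0ℚ < x a b → 0ℚ < x a' b →
                aboveʳ b a + x a b ≤ aboveʳ b a' → aboveˡ a' b + x a' b ≤ aboveˡ a b
      reflect 0<x 0<x' h = subst₂ _≤_ (sym (tight-upper 0<x')) (sym (tight-lower 0<x)) (1-antimono h)

    matchingAt : ℚ → EdgeSet G
    matchingAt t a b = ⌊ t ∈?[ aboveˡ a b , aboveˡ a b + x a b ⟩ ⌋

    matchingAt-intro : ∀ t a b → t ∈[ aboveˡ a b , aboveˡ a b + x a b ⟩ → T (matchingAt t a b)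
    matchingAt-intro t a b = fromWitness {a? = t ∈?[ aboveˡ a b , aboveˡ a b + x a b ⟩}

    matchingAt-elim : ∀ t a b → T (matchingAt t a b) → t ∈[ aboveˡ a b , aboveˡ a b + x a b ⟩
    matchingAt-elim t a b = toWitness {a? = t ∈?[ aboveˡ a b , aboveˡ a b + x a b ⟩}

    matchingAt-isMatching : ∀ t → IsMatching G (matchingAt t)
    matchingAt-isMatching t =
      (λ a b Mab → support⊆E (interval-width-pos (matchingAt-elim t a b Mab))) ,
      (λ a b b' Mab Mab' → interval-unique (aboveˡ a) (x a) (AtLeft.separated a (x-nonNeg a) (chainˡ a))
                             b b' (matchingAt-elim t a b Mab) (matchingAt-elim t a b' Mab')) ,
      (λ a a' b Mab Ma'b → interval-unique (λ a → aboveˡ a b) (λ a → x a b) (separatedʳ b)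
                             a a' (matchingAt-elim t a b Mab) (matchingAt-elim t a' b Ma'b))

    better-left-partner : ∀ {t a b} → 0ℚ ≤ t → t < aboveˡ a b →
                          ∃[ i ] T (prefL a i b) × T (matchingAt t a i)
    better-left-partner {t} {a} {b} 0≤t t<A =
      partner (AtLeft.crossing a (x-nonNeg a) (chainˡ a) (t <?_) (≤⇒≯ 0≤t) b t<A)
      where
      partner : ∃[ i ] T (prefL a i b) × 0ℚ < x a i × ¬ t < aboveˡ a i × t < aboveˡ a i + x a i →
                ∃[ i ] T (prefL a i b) × T (matchingAt t a i)
      partner (i , i>b , _ , t≮A , t<A+x) = i , i>b , matchingAt-intro t a i (≮⇒≥ t≮A , t<A+x)

    tight-lower-≤ : ∀ {a b t} → 0ℚ < x a b → 1ℚ - t ≤ aboveʳ b a + x a b → aboveˡ a b ≤ t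
    tight-lower-≤ 0<x gap≤C+x = ≤-trans (≤-reflexive (tight-lower 0<x)) (1-p≤q⇒1-q≤p gap≤C+x)

    tight-upper-> : ∀ {a b t} → 0ℚ < x a b → aboveʳ b a < 1ℚ - t → t < aboveˡ a b + x a b
    tight-upper-> 0<x C<gap = <-≤-trans (p<1-q⇒q<1-p C<gap) (≤-reflexive (sym (tight-upper 0<x)))

    better-right-partner : ∀ {t a b} → t < 1ℚ → 1ℚ - t ≤ aboveʳ b a →
                           ∃[ j ] T (prefR b j a) × T (matchingAt t j b)
    better-right-partner {t} {a} {b} t<1 gap≤C =
      partner (AtRight.crossing b (λ a → x-nonNeg a b) (chainʳ b) {Q = λ v → 1ℚ - t ≤ v}
                 (λ v → 1ℚ - t ≤? v) (λ gap≤0 → ≤⇒≯ gap≤0 (p<q⇒0<q-p t<1)) a gap≤C)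
      where
      partner : ∃[ j ] T (prefR b j a) × 0ℚ < x j b ×
                       ¬ 1ℚ - t ≤ aboveʳ b j × 1ℚ - t ≤ aboveʳ b j + x j b →
                ∃[ j ] T (prefR b j a) × T (matchingAt t j b)
      partner (j , j>a , 0<x , gap≰C , gap≤C+x) =
        j , j>a , matchingAt-intro t j b (tight-lower-≤ 0<x gap≤C+x , tight-upper-> 0<x (≰⇒> gap≰C))

    gap≤aboveʳ : ∀ {a b t} → T (adj a b) → aboveˡ a b + x a b ≤ t → 1ℚ - t ≤ aboveʳ b a
    gap≤aboveʳ {a} {b} {t} adj-ab A+x≤t = ≤-fromDiff (regroup (aboveˡ a b) (aboveʳ b a) (x a b) t)
      (+-nonNeg (p≤q⇒0≤q-p (dominance≥1 adj-ab)) (p≤q⇒0≤q-p A+x≤t))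
      where
      regroup : ∀ A C u t → C - (1ℚ - t) ≡ (A + C + u - 1ℚ) + (t - (A + u))
      regroup = solve-∀ ℚ-ring

    matchingAt-unblocked : ∀ {t} → 0ℚ ≤ t → t < 1ℚ → ∀ a b → ¬ Blocks G (matchingAt t) a b
    matchingAt-unblocked {t} 0≤t t<1 a b (adj-ab , ¬Mab , ¬betterˡ , ¬betterʳ) with t <? aboveˡ a b
    ... | yes t<A = let i , i>b , Mai = better-left-partner 0≤t t<A in ¬betterˡ i Mai i>b
    ... | no t≮A =
          let j , j>a , Mjb = better-right-partner t<1 (gap≤aboveʳ adj-ab A+x≤t) in ¬betterʳ j Mjb j>a
      where
      A+x≤t : aboveˡ a b + x a b ≤ t
      A+x≤t = ≮⇒≥ (¬Mab ∘ matchingAt-intro t a b ∘ (≮⇒≥ t≮A ,_))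

    matchingAt-superStable : ∀ {t} → 0ℚ ≤ t → t < 1ℚ → IsSuperStable G (matchingAt t)
    matchingAt-superStable {t} 0≤t t<1 = matchingAt-isMatching t , matchingAt-unblocked 0≤t t<1

    endpointsOf : Fin m × Fin k → List ℚ
    endpointsOf (a , b) = aboveˡ a b ∷ aboveˡ a b + x a b ∷ []

    endpoints : List ℚ
    endpoints = concatMap endpointsOf (cartesianProduct (allFin m) (allFin k))

    endpoint-∈ : ∀ a b {y} → y ∈ endpointsOf (a , b) → y ∈ endpoints
    endpoint-∈ a b y∈ =
      ∈-concatMap⁺ endpointsOf (lose (∈-cartesianProduct⁺ (∈-allFin a) (∈-allFin b)) y∈)

    endpoints-bounded : All UnitInterval endpoints
    endpoints-bounded = concat⁺ (map⁺ (universal bounded (cartesianProduct (allFin m) (allFin k))))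
      where
      bounded : ∀ e → All UnitInterval (endpointsOf e)
      bounded (a , b) = (0≤A , ≤-trans A≤A+x A+x≤1) ∷ (≤-trans 0≤A A≤A+x , A+x≤1) ∷ []
        where
        0≤A = AtLeft.above-nonNeg a (x-nonNeg a) b
        A≤A+x = p≤p+q (x-nonNeg a b)
        A+x≤1 = ≤-trans (AtLeft.above+w≤∑ a (x-nonNeg a) b) (degreeˡ≤1 a)

    assemble : ∀ L → Sorted L → All UnitInterval L → 0ℚ ∈ L → 1ℚ ∈ L →
               (∀ a b → aboveˡ a b ∈ L) → (∀ a b → aboveˡ a b + x a b ∈ L) →
               InSuperStableHull G x
    assemble (t ∷ ts) sorted bounded@((0≤t , _) ∷ _) 0∈ 1∈ lo∈ hi∈ =
      pieces matchingAt t ts , pieces-good matchingAt matchingAt-superStable ts bounded ,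
      weights , decomposition
      where
      weights : weightSum G (pieces matchingAt t ts) ≡ 1ℚ
      weights = trans (weightSum-pieces matchingAt ts sorted) (trans (riemann-one t ts)
        (cong₂ _-_ (≤-antisym (proj₂ (All-final ts bounded)) (≤-final sorted 1∈))
                   (≤-antisym (sorted-head sorted 0∈) 0≤t)))
      decomposition : ∀ a b → x a b ≡ combo G (pieces matchingAt t ts) a b
      decomposition a b = sym (trans (combo-pieces matchingAt ts sorted a b)
        (trans (riemann-interval ts (p≤p+q (x-nonNeg a b)) sorted (lo∈ a b) (hi∈ a b))
               (cancel (aboveˡ a b) (x a b))))
        where
        cancel : ∀ A u → A + u - A ≡ u
        cancel = solve-∀ ℚ-ring

    polytope⊆hull : InSuperStableHull G x
    polytope⊆hull = assemble (sort breakpoints) (sort-↗ breakpoints)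
      (All-resp-↭ (↭-sym (sort-↭ breakpoints)) ((≤-refl , 0≤1) ∷ (0≤1 , ≤-refl) ∷ endpoints-bounded))
      (sorted (here refl)) (sorted (there (here refl)))
      (λ a b → sorted (there (there (endpoint-∈ a b (here refl)))))
      (λ a b → sorted (there (there (endpoint-∈ a b (there (here refl))))))
      where
      breakpoints = 0ℚ ∷ 1ℚ ∷ endpoints
      sorted : ∀ {y} → y ∈ breakpoints → y ∈ sort breakpoints
      sorted = ∈-resp-↭ (↭-sym (sort-↭ breakpoints))

mainTheorem8 : ∀ {m k : ℕ} (G : PrefGraph m k) (x : Fin m → Fin k → ℚ) →
    Vec^E G x → (InSuperStableHull G x ⇔ InPolytope G x)
mainTheorem8 G x x-vanishes = mk⇔ (hull⊆polytope G x) (Decomposition.polytope⊆hull G x x-vanishes)
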